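{- Let $n\ge 2$ and let $T$ be a finite tree with at least three vertices all of whose vertices have valence $1$ or $n$. Let $T_i$ be the subtree of internal vertices of $T$, let $\operatorname{Res}\colon \operatorname{Aut}(T)\to\operatorname{Aut}(T_i)$ be the restriction map and $\operatorname{Aut}_e=\ker(\operatorname{Res})$. Then the sequence \[1\longrightarrow \operatorname{Aut}_e\longrightarrow \operatorname{Aut}(T)\xrightarrow{\operatorname{Res}}\operatorname{Aut}(T_i)\longrightarrow 1\] is exact, and $\operatorname{Res}$ has a section which is a group homomorphism $\psi\colon \operatorname{Aut}(T_i)\to\operatorname{Aut}(T)$. Consequently $\operatorname{Aut}(T)\simeq \operatorname{Aut}_e\rtimes \operatorname{Aut}(T_i)$.
   Context: All graphs are finite. An external vertex of a tree is a vertex of valence $1$; an internal vertex is a vertex of valence $>1$. The subtree of internal vertices $T_i$ is the tree whose vertex set is the set of internal vertices of $T$ and whose edges are the edges of $T$ joining two internal vertices. Since graph automorphisms preserve valence, every automorphism of $T$ maps internal vertices to internal vertices, so restriction gives a group homomorphism $\operatorname{Res}\colon\operatorname{Aut}(T)\to\operatorname{Aut}(T_i)$. -}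

module Defs where

open import Data.Bool using (Bool; true; false; if_then_else_)
open import Data.Nat using (ℕ; zero; suc; _<_)
open import Data.Nat.Properties using (+-0-commutativeMonoid; <-irrelevant)
open import Data.Fin using (Fin)
open import Data.Fin.Permutation using (Permutation′; _⟨$⟩ʳ_; _⟨$⟩ˡ_; inverseˡ; inverseʳ)
open import Data.List using (List; []; _∷_)
open import Data.List.Relation.Unary.Unique.Propositional using (Unique)
open import Function.Construct.Composition using (_↔-∘_)
open import Data.Product using (Σ; ∃; _×_; _,_; proj₁; proj₂)
open import Data.Empty using (⊥)
open import Data.Unit using (⊤)
open import Relation.Nullary using (¬_)
open import Relation.Binary.PropositionalEquality
  using (_≡_; refl; sym; trans; cong; cong₂; subst)
open import Algebra.Properties.CommutativeMonoid.Sum +-0-commutativeMonoid using (sum; sum-permute; sum-cong-≗)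

record Graph (N : ℕ) : Set where
  field
    adj    : Fin N → Fin N → Bool
    symm   : ∀ u v → adj u v ≡ adj v u
    irrefl : ∀ v → adj v v ≡ false
open Graph public

module Tree {N : ℕ} (G : Graph N) where

  data Walk : Fin N → Fin N → Set where
    nil  : ∀ {v} → Walk v v
    cons : ∀ {u w v} → adj G u w ≡ true → Walk w v → Walk u v

  Connected : Set
  Connected = ∀ u v → Walk u v

  Chain : List (Fin N) → Set
  Chain []           = ⊤
  Chain (x ∷ [])     = ⊤
  Chain (x ∷ y ∷ r)  = (adj G x y ≡ true) × Chain (y ∷ r)

  lastOf : Fin N → List (Fin N) → Fin N
  lastOf x []      = x
  lastOf x (y ∷ r) = lastOf y r

  IsCycle : List (Fin N) → Set
  IsCycle []                = ⊥
  IsCycle (x ∷ [])          = ⊥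
  IsCycle (x ∷ y ∷ [])      = ⊥
  IsCycle (x ∷ y ∷ z ∷ r)   =
    Unique (x ∷ y ∷ z ∷ r) × Chain (x ∷ y ∷ z ∷ r) × (adj G (lastOf z r) x ≡ true)

  Acyclic : Set
  Acyclic = ∀ (cs : List (Fin N)) → ¬ IsCycle cs

  IsTree : Set
  IsTree = Connected × Acyclic

  valence : Fin N → ℕ
  valence v = sum (λ u → if adj G v u then 1 else 0)

  Internal : Fin N → Set
  Internal v = 1 < valence v

  IVert : Set
  IVert = Σ (Fin N) Internal

  record Aut : Set where
    field
      perm      : Permutation′ N
      preserves : ∀ u v → adj G (perm ⟨$⟩ʳ u) (perm ⟨$⟩ʳ v) ≡ adj G u v
  open Aut public

  app : Aut → Fin N → Fin N
  app σ v = perm σ ⟨$⟩ʳ v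

  _≈A_ : Aut → Aut → Set
  σ ≈A ρ = ∀ v → app σ v ≡ app ρ v

  -- Aut(T_i): bijections of the internal vertices preserving adjacency
  -- (the edges of T_i are the edges of T joining internal vertices)

  record AutI : Set where
    field
      to        : IVert → IVert
      from      : IVert → IVert
      to-from   : ∀ x → to (from x) ≡ x
      from-to   : ∀ x → from (to x) ≡ x
      preservesI : ∀ x y → adj G (proj₁ (to x)) (proj₁ (to y)) ≡ adj G (proj₁ x) (proj₁ y)
  open AutI public

  appI : AutI → IVert → Fin N
  appI τ x = proj₁ (to τ x)

  _≈I_ : AutI → AutI → Set
  τ ≈I ρ = ∀ x → appI τ x ≡ appI ρ x

  _∘I_ : AutI → AutI → AutI
  τ ∘I ρ = record
    { to = λ x → to τ (to ρ x)
    ; from = λ x → from ρ (from τ x)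
    ; to-from = λ x → trans (cong (to τ) (to-from ρ (from τ x))) (to-from τ x)
    ; from-to = λ x → trans (cong (from ρ) (from-to τ (to ρ x))) (from-to ρ x)
    ; preservesI = λ x y → trans (preservesI τ (to ρ x) (to ρ y)) (preservesI ρ x y)
    }

  valence-pres : (σ : Aut) → ∀ v → valence (app σ v) ≡ valence v
  valence-pres σ v =
    trans (sum-permute (λ u → if adj G (app σ v) u then 1 else 0) (perm σ))
          (sum-cong-≗ (λ u → cong (λ b → if b then 1 else 0) (preserves σ v u)))

  internal-pres : (σ : Aut) → ∀ v → Internal v → Internal (app σ v)
  internal-pres σ v p = subst (1 <_) (sym (valence-pres σ v)) p

  inv-pres : (σ : Aut) → ∀ u v →
             adj G (perm σ ⟨$⟩ˡ u) (perm σ ⟨$⟩ˡ v) ≡ adj G u v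
  inv-pres σ u v =
    trans (sym (preserves σ (perm σ ⟨$⟩ˡ u) (perm σ ⟨$⟩ˡ v)))
          (cong₂ (adj G) (inverseʳ (perm σ)) (inverseʳ (perm σ)))

  internal-pres⁻ : (σ : Aut) → ∀ v → Internal v → Internal (perm σ ⟨$⟩ˡ v)
  internal-pres⁻ σ v p =
    subst (1 <_) (trans (sym (cong valence (inverseʳ (perm σ))))
                        (valence-pres σ (perm σ ⟨$⟩ˡ v))) p

  IVert-≡ : ∀ {x y : IVert} → proj₁ x ≡ proj₁ y → x ≡ y
  IVert-≡ {a , p} {.a , q} refl = cong (a ,_) (<-irrelevant p q)

  Res : Aut → AutI
  Res σ = record
    { to   = λ x → app σ (proj₁ x) , internal-pres σ (proj₁ x) (proj₂ x)
    ; from = λ x → perm σ ⟨$⟩ˡ proj₁ x , internal-pres⁻ σ (proj₁ x) (proj₂ x)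
    ; to-from = λ x → IVert-≡ (inverseʳ (perm σ))
    ; from-to = λ x → IVert-≡ (inverseˡ (perm σ))
    ; preservesI = λ x y → preserves σ (proj₁ x) (proj₁ y)
    }

  InKer : Aut → Set
  InKer σ = ∀ (x : IVert) → appI (Res σ) x ≡ proj₁ x

  _∘A_ : Aut → Aut → Aut
  σ ∘A ρ = record
    { perm = perm σ ↔-∘ perm ρ
    ; preserves = λ u v → trans (preserves σ (app ρ u) (app ρ v)) (preserves ρ u v)
    }

{-# OPTIONS --safe #-}
-- Every leaf u of T hangs from a unique neighbour, its parent, which is internal (a leaf
-- adjacent to a leaf would span a component {u, parent u}, impossible once N ≥ 3).  An
-- automorphism τ of T_i preserves internal degrees, and every internal vertex has
-- valence n, so the parents x and τ x carry equally many leaves.  Listing the leaves of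
-- each vertex in increasing order, ψ τ sends the i-th leaf of x to the i-th leaf of τ x;
-- this choice is canonical, hence ψ is a homomorphism and a section of Res, and the
-- semidirect decomposition σ = (σ ∘ ψ (Res σ)⁻¹) ∘ ψ (Res σ) follows formally.
module Submission where

open import Defs
open import Data.Bool using (Bool; true; false; if_then_else_; _∧_; not)
open import Data.Bool.Properties using (∧-zeroʳ; T-≡; T-not-≡; T-∧; ⇔→≡; ¬-not)
open import Data.Empty using (⊥-elim)
open import Data.Fin using (Fin; zero; suc) renaming (_≟_ to _≟ᶠ_)
open import Data.Fin.Permutation using (Permutation′; _⟨$⟩ʳ_; permutation)
open import Data.Fin.Properties using (pigeonhole) renaming (<-irrefl to <ᶠ-irrefl)
open import Data.List using (List; []; _∷_; length; filterᵇ; allFin; tabulate)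
open import Data.List.Membership.Propositional using (_∈_)
open import Data.List.Membership.Propositional.Properties using (∈-filter⁺; ∈-filter⁻; ∈-allFin)
open import Data.List.Relation.Unary.All using (lookup)
open import Data.List.Relation.Unary.AllPairs using (_∷_)
open import Data.List.Relation.Unary.Any using (here; there)
open import Data.List.Relation.Unary.Unique.Propositional using (Unique)
open import Data.List.Relation.Unary.Unique.Propositional.Properties using (filter⁺; allFin⁺)
open import Data.Nat using (ℕ; zero; suc; _+_; _≤_; _<_; s≤s; z≤n; _<?_)
open import Data.Nat.Properties using (+-0-commutativeMonoid; +-cancelˡ-≡; <-irrefl)
open import Algebra.Properties.CommutativeMonoid.Sum +-0-commutativeMonoid
  using (sum; sum-permute; sum-cong-≗; ∑-distrib-+)
open import Data.Product using (Σ; ∃; _×_; _,_; proj₁; proj₂)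
open import Data.Sum using (_⊎_; inj₁; inj₂; [_,_])
open import Function using (_∘_; id; Equivalence; mk⇔)
open import Relation.Binary.Definitions using (DecidableEquality)
open import Relation.Binary.PropositionalEquality
  using (_≡_; refl; sym; trans; cong; cong₂; subst; module ≡-Reasoning)
open import Relation.Nullary using (¬_; Dec; yes; no)
open import Relation.Nullary.Decidable using (T?; isYes; toSum; fromWitness; toWitnessFalse; fromWitnessFalse)

module _ {A : Set} where

  lookupOr : A → List A → ℕ → A
  lookupOr d []       _       = d
  lookupOr d (x ∷ xs) zero    = x
  lookupOr d (x ∷ xs) (suc i) = lookupOr d xs i

  lookupOr-∈ : ∀ d xs {i} → i < length xs → lookupOr d xs i ∈ xs
  lookupOr-∈ d (x ∷ xs) {zero}  _         = here refl
  lookupOr-∈ d (x ∷ xs) {suc i} (s≤s i<n) = there (lookupOr-∈ d xs i<n)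

  lookupOr-irrelevant : ∀ d d′ xs {i} → i < length xs → lookupOr d xs i ≡ lookupOr d′ xs i
  lookupOr-irrelevant d d′ (x ∷ xs) {zero}  _         = refl
  lookupOr-irrelevant d d′ (x ∷ xs) {suc i} (s≤s i<n) = lookupOr-irrelevant d d′ xs i<n

  ∈-length≡1⇒≡head : ∀ d {a} xs → length xs ≡ 1 → a ∈ xs → a ≡ lookupOr d xs 0
  ∈-length≡1⇒≡head d (x ∷ []) _ (here a≡x) = a≡x

module _ {A : Set} (_≟_ : DecidableEquality A) where

  indexOf : A → List A → ℕ
  indexOf a []       = 0
  indexOf a (x ∷ xs) with a ≟ x
  ... | yes _ = 0
  ... | no  _ = suc (indexOf a xs)

  indexOf-< : ∀ {a xs} → a ∈ xs → indexOf a xs < length xs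
  indexOf-< {a} {x ∷ xs} a∈ with a ≟ x
  indexOf-< {a} {x ∷ xs} _          | yes _   = s≤s z≤n
  indexOf-< {a} {x ∷ xs} (here a≡x) | no a≢x = ⊥-elim (a≢x a≡x)
  indexOf-< {a} {x ∷ xs} (there a∈) | no _   = s≤s (indexOf-< a∈)

  lookupOr-indexOf : ∀ d {a xs} → a ∈ xs → lookupOr d xs (indexOf a xs) ≡ a
  lookupOr-indexOf d {a} {x ∷ xs} a∈ with a ≟ x
  lookupOr-indexOf d {a} {x ∷ xs} _          | yes a≡x = sym a≡x
  lookupOr-indexOf d {a} {x ∷ xs} (here a≡x) | no a≢x  = ⊥-elim (a≢x a≡x)
  lookupOr-indexOf d {a} {x ∷ xs} (there a∈) | no _    = lookupOr-indexOf d a∈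

  indexOf-lookupOr : ∀ d {xs i} → Unique xs → i < length xs → indexOf (lookupOr d xs i) xs ≡ i
  indexOf-lookupOr d {x ∷ xs} {zero} _ _ with x ≟ x
  ... | yes _   = refl
  ... | no x≢x = ⊥-elim (x≢x refl)
  indexOf-lookupOr d {x ∷ xs} {suc i} (x∉xs ∷ xs!) (s≤s i<n) with lookupOr d xs i ≟ x
  ... | yes y≡x = ⊥-elim (lookup x∉xs (lookupOr-∈ d xs i<n) (sym y≡x))
  ... | no _    = cong suc (indexOf-lookupOr d xs! i<n)

count : ∀ {n} → (Fin n → Bool) → ℕ
count p = sum (λ i → if p i then 1 else 0)

count-cong : ∀ {n} {p q : Fin n → Bool} → (∀ i → p i ≡ q i) → count p ≡ count q
count-cong p≗q = sum-cong-≗ (λ i → cong (λ b → if b then 1 else 0) (p≗q i))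

count-permute : ∀ {n} (p : Fin n → Bool) (π : Permutation′ n) → count p ≡ count (p ∘ (π ⟨$⟩ʳ_))
count-permute p π = sum-permute (λ i → if p i then 1 else 0) π

count-split : ∀ {n} (p q : Fin n → Bool) →
              count p ≡ count (λ i → p i ∧ q i) + count (λ i → p i ∧ not (q i))
count-split p q =
  trans (sum-cong-≗ (λ i → indicator-split (p i) (q i)))
        (∑-distrib-+ (λ i → if p i ∧ q i then 1 else 0) (λ i → if p i ∧ not (q i) then 1 else 0))
  where
    indicator-split : ∀ a b →
      (if a then 1 else 0) ≡ (if a ∧ b then 1 else 0) + (if a ∧ not b then 1 else 0)
    indicator-split true  true  = refl
    indicator-split true  false = refl
    indicator-split false _     = refl

count≡length-filterᵇ : ∀ {A : Set} {n} (p : A → Bool) (g : Fin n → A) →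
                       count (p ∘ g) ≡ length (filterᵇ p (tabulate g))
count≡length-filterᵇ {n = zero}  p g = refl
count≡length-filterᵇ {n = suc n} p g with p (g zero)
... | true  = cong suc (count≡length-filterᵇ p (g ∘ suc))
... | false = count≡length-filterᵇ p (g ∘ suc)

¬covered-by-two : ∀ {N} → 2 < N → (a b : Fin N) → ¬ (∀ z → z ≡ a ⊎ z ≡ b)
¬covered-by-two 2<N a b cover
  with i , j , i<j , fi≡fj ← pigeonhole 2<N (λ z → [ (λ _ → zero) , (λ _ → suc zero) ] (cover z))
  with cover i | cover j
... | inj₁ i≡a | inj₁ j≡a = <ᶠ-irrefl (trans i≡a (sym j≡a)) i<j
... | inj₂ i≡b | inj₂ j≡b = <ᶠ-irrefl (trans i≡b (sym j≡b)) i<j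
... | inj₁ _   | inj₂ _   with () ← fi≡fj
... | inj₂ _   | inj₁ _   with () ← fi≡fj

module GraphFacts {N : ℕ} (G : Graph N) where
  open Tree G

  adj-sym : ∀ {u w} → adj G u w ≡ true → adj G w u ≡ true
  adj-sym {u} {w} e = trans (symm G w u) e

  walk-preserves : (P : Fin N → Set) → (∀ {x y} → adj G x y ≡ true → P x → P y) →
                   ∀ {u v} → Walk u v → P u → P v
  walk-preserves P step nil        p = p
  walk-preserves P step (cons e w) p = walk-preserves P step w (step e p)

  neighbours : Fin N → List (Fin N)
  neighbours u = filterᵇ (adj G u) (allFin N)

  ∈-neighbours⁺ : ∀ {u w} → adj G u w ≡ true → w ∈ neighbours u
  ∈-neighbours⁺ {u} {w} e = ∈-filter⁺ (T? ∘ adj G u) (∈-allFin w) (Equivalence.from T-≡ e)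

  ∈-neighbours⁻ : ∀ {u w} → w ∈ neighbours u → adj G u w ≡ true
  ∈-neighbours⁻ {u} w∈ = Equivalence.to T-≡ (proj₂ (∈-filter⁻ (T? ∘ adj G u) {xs = allFin N} w∈))

  valence≡length-neighbours : ∀ u → valence u ≡ length (neighbours u)
  valence≡length-neighbours u = count≡length-filterᵇ (adj G u) id

  firstNeighbour : Fin N → Fin N
  firstNeighbour u = lookupOr u (neighbours u) 0

  module _ {u : Fin N} (valence≡1 : valence u ≡ 1) where

    length-neighbours≡1 : length (neighbours u) ≡ 1
    length-neighbours≡1 = trans (sym (valence≡length-neighbours u)) valence≡1

    adj-firstNeighbour : adj G u (firstNeighbour u) ≡ true
    adj-firstNeighbour = ∈-neighbours⁻ (lookupOr-∈ u (neighbours u)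
                           (subst (0 <_) (sym length-neighbours≡1) (s≤s z≤n)))

    adj⇒≡firstNeighbour : ∀ {w} → adj G u w ≡ true → w ≡ firstNeighbour u
    adj⇒≡firstNeighbour e = ∈-length≡1⇒≡head u (neighbours u) length-neighbours≡1 (∈-neighbours⁺ e)

  internal? : (v : Fin N) → Dec (Internal v)
  internal? v = 1 <? valence v

  internalᵇ : Fin N → Bool
  internalᵇ v = isYes (internal? v)

  -- Case splits go through internal-or-leaf rather than a 'with' on internal?, which
  -- would also unfold extend and lift in the goal.
  internal-or-leaf : ∀ v → Internal v ⊎ ¬ Internal v
  internal-or-leaf v = toSum (internal? v)

  idI : AutI
  idI = record { to = id ; from = id ; to-from = λ _ → refl ; from-to = λ _ → refl
               ; preservesI = λ _ _ → refl }

  invI : AutI → AutI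
  invI τ = record
    { to = from τ ; from = to τ ; to-from = from-to τ ; from-to = to-from τ
    ; preservesI = λ x y → trans (sym (preservesI τ (from τ x) (from τ y)))
                                 (cong₂ (λ a b → adj G (proj₁ a) (proj₁ b)) (to-from τ x) (to-from τ y))
    }

  invI-inverseʳ : ∀ τ → (τ ∘I invI τ) ≈I idI
  invI-inverseʳ τ x = cong proj₁ (to-from τ x)

  invI-inverseˡ : ∀ τ → (invI τ ∘I τ) ≈I idI
  invI-inverseˡ τ x = cong proj₁ (from-to τ x)

  invI-cong : ∀ {τ ρ} → τ ≈I ρ → invI τ ≈I invI ρ
  invI-cong {τ} {ρ} τ≈ρ x = cong proj₁ (begin
    from τ x                  ≡⟨ sym (from-to ρ (from τ x)) ⟩
    from ρ (to ρ (from τ x))  ≡⟨ cong (from ρ) (IVert-≡ (sym (τ≈ρ (from τ x)))) ⟩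
    from ρ (to τ (from τ x))  ≡⟨ cong (from ρ) (to-from τ x) ⟩
    from ρ x                  ∎)
    where open ≡-Reasoning

  extend : AutI → Fin N → Fin N
  extend τ v with internal? v
  ... | yes v-int = appI τ (v , v-int)
  ... | no  _     = v

  extend-internal : ∀ τ {v} (v-int : Internal v) → extend τ v ≡ appI τ (v , v-int)
  extend-internal τ {v} v-int with internal? v
  ... | yes _      = cong (appI τ) (IVert-≡ refl)
  ... | no  v-leaf = ⊥-elim (v-leaf v-int)

  extend-leaf : ∀ τ {v} → ¬ Internal v → extend τ v ≡ v
  extend-leaf τ {v} v-leaf with internal? v
  ... | yes v-int = ⊥-elim (v-leaf v-int)
  ... | no  _     = refl

  Internal-extend : ∀ τ {v} → Internal v → Internal (extend τ v)
  Internal-extend τ v-int = subst Internal (sym (extend-internal τ v-int)) (proj₂ (to τ (_ , v-int)))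

  extend-adj : ∀ τ {u v} → Internal u → Internal v → adj G (extend τ u) (extend τ v) ≡ adj G u v
  extend-adj τ u-int v-int =
    trans (cong₂ (adj G) (extend-internal τ u-int) (extend-internal τ v-int))
          (preservesI τ (_ , u-int) (_ , v-int))

  extend-∘ : ∀ τ ρ v → extend (τ ∘I ρ) v ≡ extend τ (extend ρ v)
  extend-∘ τ ρ v with internal-or-leaf v
  ... | inj₁ v-int  = trans (extend-internal (τ ∘I ρ) v-int)
                            (trans (sym (extend-internal τ (proj₂ (to ρ (v , v-int)))))
                                   (cong (extend τ) (sym (extend-internal ρ v-int))))
  ... | inj₂ v-leaf = trans (extend-leaf (τ ∘I ρ) v-leaf)
                            (sym (trans (cong (extend τ) (extend-leaf ρ v-leaf)) (extend-leaf τ v-leaf)))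

  extend-cong : ∀ {τ ρ} → τ ≈I ρ → ∀ v → extend τ v ≡ extend ρ v
  extend-cong {τ} {ρ} τ≈ρ v with internal-or-leaf v
  ... | inj₁ v-int  = trans (extend-internal τ v-int)
                            (trans (τ≈ρ (v , v-int)) (sym (extend-internal ρ v-int)))
  ... | inj₂ v-leaf = trans (extend-leaf τ v-leaf) (sym (extend-leaf ρ v-leaf))

  extend-id : ∀ v → extend idI v ≡ v
  extend-id v with internal-or-leaf v
  ... | inj₁ v-int  = extend-internal idI v-int
  ... | inj₂ v-leaf = extend-leaf idI v-leaf

  extend-inverseˡ : ∀ τ v → extend τ (extend (invI τ) v) ≡ v
  extend-inverseˡ τ v =
    trans (sym (extend-∘ τ (invI τ) v)) (trans (extend-cong (invI-inverseʳ τ) v) (extend-id v))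

  extend-inverseʳ : ∀ τ v → extend (invI τ) (extend τ v) ≡ v
  extend-inverseʳ τ v =
    trans (sym (extend-∘ (invI τ) τ v)) (trans (extend-cong (invI-inverseˡ τ) v) (extend-id v))

  extendPerm : AutI → Permutation′ N
  extendPerm τ = permutation (extend τ) (extend (invI τ)) (extend-inverseˡ τ) (extend-inverseʳ τ)

  internalDegree : Fin N → ℕ
  internalDegree x = count (λ w → adj G x w ∧ internalᵇ w)

  internalDegree-extend : ∀ τ {x} → Internal x → internalDegree (extend τ x) ≡ internalDegree x
  internalDegree-extend τ {x} x-int =
    trans (count-permute (λ w → adj G (extend τ x) w ∧ internalᵇ w) (extendPerm τ)) (count-cong term)
    where
      term : ∀ w → adj G (extend τ x) (extend τ w) ∧ internalᵇ (extend τ w) ≡ adj G x w ∧ internalᵇ w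
      term w with internal-or-leaf w
      ... | inj₁ w-int  = cong₂ _∧_ (extend-adj τ x-int w-int)
                            (trans (Equivalence.to T-≡ (fromWitness (Internal-extend τ w-int)))
                                   (sym (Equivalence.to T-≡ (fromWitness {a? = internal? w} w-int))))
      ... | inj₂ w-leaf =
        trans (cong (λ v → adj G (extend τ x) v ∧ internalᵇ v) (extend-leaf τ w-leaf))
              (∧-false (Equivalence.to T-not-≡ (fromWitnessFalse {a? = internal? w} w-leaf)))
        where
          ∧-false : ∀ {a a′ b} → b ≡ false → a ∧ b ≡ a′ ∧ b
          ∧-false {a} {a′} refl = trans (∧-zeroʳ a) (sym (∧-zeroʳ a′))

  leaves : Fin N → List (Fin N)
  leaves x = filterᵇ (λ w → adj G x w ∧ not (internalᵇ w)) (allFin N)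

  valence≡internalDegree+length-leaves : ∀ x → valence x ≡ internalDegree x + length (leaves x)
  valence≡internalDegree+length-leaves x =
    trans (count-split (adj G x) internalᵇ)
          (cong (internalDegree x +_) (count≡length-filterᵇ (λ w → adj G x w ∧ not (internalᵇ w)) id))

  ∈-leaves⁺ : ∀ {x w} → adj G x w ≡ true → ¬ Internal w → w ∈ leaves x
  ∈-leaves⁺ {x} {w} e w-leaf =
    ∈-filter⁺ (T? ∘ (λ w → adj G x w ∧ not (internalᵇ w))) (∈-allFin w)
              (Equivalence.from (T-∧ {adj G x w}) (Equivalence.from T-≡ e , fromWitnessFalse w-leaf))

  ∈-leaves⁻ : ∀ {x w} → w ∈ leaves x → adj G x w ≡ true × ¬ Internal w
  ∈-leaves⁻ {x} w∈ with adjT , leafT ← Equivalence.to T-∧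
      (proj₂ (∈-filter⁻ (T? ∘ (λ w → adj G x w ∧ not (internalᵇ w))) {xs = allFin N} w∈))
    = Equivalence.to T-≡ adjT , toWitnessFalse leafT

  leaves-unique : ∀ x → Unique (leaves x)
  leaves-unique x = filter⁺ _ (allFin⁺ N)

module LeafExtension {n N : ℕ} (2≤n : 2 ≤ n) (3≤N : 3 ≤ N) (G : Graph N)
  (connected : Tree.Connected G)
  (valence-1-or-n : ∀ v → Tree.valence G v ≡ 1 ⊎ Tree.valence G v ≡ n) where
  open Tree G
  open GraphFacts G

  leaf-valence : ∀ {v} → ¬ Internal v → valence v ≡ 1
  leaf-valence {v} v-leaf with valence-1-or-n v
  ... | inj₁ ≡1 = ≡1
  ... | inj₂ ≡n = ⊥-elim (v-leaf (subst (1 <_) (sym ≡n) 2≤n))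

  internal-valence : ∀ {v} → Internal v → valence v ≡ n
  internal-valence {v} v-int with valence-1-or-n v
  ... | inj₁ ≡1 = ⊥-elim (<-irrefl (sym ≡1) v-int)
  ... | inj₂ ≡n = ≡n

  parent : Fin N → Fin N
  parent = firstNeighbour

  adj-parent : ∀ {u} → ¬ Internal u → adj G u (parent u) ≡ true
  adj-parent u-leaf = adj-firstNeighbour (leaf-valence u-leaf)

  leaf-adj⇒≡parent : ∀ {u w} → ¬ Internal u → adj G u w ≡ true → w ≡ parent u
  leaf-adj⇒≡parent u-leaf = adj⇒≡firstNeighbour (leaf-valence u-leaf)

  parent-internal : ∀ {u} → ¬ Internal u → Internal (parent u)
  parent-internal {u} u-leaf with internal-or-leaf (parent u)
  ... | inj₁ p-int  = p-int
  ... | inj₂ p-leaf = ⊥-elim (¬covered-by-two 3≤N u (parent u)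
                        (λ z → walk-preserves Near step (connected u z) (inj₁ refl)))
    where
      Near : Fin N → Set
      Near z = z ≡ u ⊎ z ≡ parent u

      step : ∀ {x y} → adj G x y ≡ true → Near x → Near y
      step e (inj₁ refl) = inj₂ (leaf-adj⇒≡parent u-leaf e)
      step e (inj₂ refl) = inj₁ (trans (leaf-adj⇒≡parent p-leaf e)
                                       (sym (leaf-adj⇒≡parent p-leaf (adj-sym (adj-parent u-leaf)))))

  leaves-nonadjacent : ∀ {u v} → ¬ Internal u → ¬ Internal v → adj G u v ≡ false
  leaves-nonadjacent u-leaf v-leaf = ¬-not λ e →
    u-leaf (subst Internal (sym (leaf-adj⇒≡parent v-leaf (adj-sym e))) (parent-internal v-leaf))

  ∈-leaves-parent : ∀ {u} → ¬ Internal u → u ∈ leaves (parent u)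
  ∈-leaves-parent u-leaf = ∈-leaves⁺ (adj-sym (adj-parent u-leaf)) u-leaf

  length-leaves-extend : ∀ τ {x} → Internal x → length (leaves (extend τ x)) ≡ length (leaves x)
  length-leaves-extend τ {x} x-int = +-cancelˡ-≡ (internalDegree x) _ _ (begin
    internalDegree x + length (leaves (extend τ x))
      ≡⟨ cong (_+ length (leaves (extend τ x))) (sym (internalDegree-extend τ x-int)) ⟩
    internalDegree (extend τ x) + length (leaves (extend τ x))
      ≡⟨ sym (valence≡internalDegree+length-leaves (extend τ x)) ⟩
    valence (extend τ x)
      ≡⟨ internal-valence (Internal-extend τ x-int) ⟩
    n
      ≡⟨ sym (internal-valence x-int) ⟩
    valence x
      ≡⟨ valence≡internalDegree+length-leaves x ⟩
    internalDegree x + length (leaves x) ∎)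
    where open ≡-Reasoning

  leafIndex : Fin N → ℕ
  leafIndex u = indexOf _≟ᶠ_ u (leaves (parent u))

  -- The default u is never returned for a leaf u: see leafIndex-<.
  liftLeaf : AutI → Fin N → Fin N
  liftLeaf τ u = lookupOr u (leaves (extend τ (parent u))) (leafIndex u)

  module _ (τ : AutI) {u : Fin N} (u-leaf : ¬ Internal u) where

    leafIndex-< : leafIndex u < length (leaves (extend τ (parent u)))
    leafIndex-< = subst (leafIndex u <_) (sym (length-leaves-extend τ (parent-internal u-leaf)))
                        (indexOf-< _≟ᶠ_ (∈-leaves-parent u-leaf))

    liftLeaf-∈ : liftLeaf τ u ∈ leaves (extend τ (parent u))
    liftLeaf-∈ = lookupOr-∈ u (leaves (extend τ (parent u))) leafIndex-<

    liftLeaf-leaf : ¬ Internal (liftLeaf τ u)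
    liftLeaf-leaf = proj₂ (∈-leaves⁻ liftLeaf-∈)

    parent-liftLeaf : parent (liftLeaf τ u) ≡ extend τ (parent u)
    parent-liftLeaf = sym (leaf-adj⇒≡parent liftLeaf-leaf (adj-sym (proj₁ (∈-leaves⁻ liftLeaf-∈))))

    leafIndex-liftLeaf : leafIndex (liftLeaf τ u) ≡ leafIndex u
    leafIndex-liftLeaf =
      trans (cong (λ x → indexOf _≟ᶠ_ (liftLeaf τ u) (leaves x)) parent-liftLeaf)
            (indexOf-lookupOr _≟ᶠ_ u (leaves-unique _) leafIndex-<)

  liftLeaf-∘ : ∀ τ ρ {u} → ¬ Internal u → liftLeaf (τ ∘I ρ) u ≡ liftLeaf τ (liftLeaf ρ u)
  liftLeaf-∘ τ ρ {u} u-leaf = begin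
    lookupOr u (leaves (extend (τ ∘I ρ) (parent u))) (leafIndex u)
      ≡⟨ cong (λ x → lookupOr u (leaves x) (leafIndex u)) (extend-∘ τ ρ (parent u)) ⟩
    lookupOr u (leaves (extend τ (extend ρ (parent u)))) (leafIndex u)
      ≡⟨ lookupOr-irrelevant u v (leaves (extend τ (extend ρ (parent u)))) index<length ⟩
    lookupOr v (leaves (extend τ (extend ρ (parent u)))) (leafIndex u)
      ≡⟨ sym (cong₂ (λ x i → lookupOr v (leaves (extend τ x)) i)
                    (parent-liftLeaf ρ u-leaf) (leafIndex-liftLeaf ρ u-leaf)) ⟩
    lookupOr v (leaves (extend τ (parent v))) (leafIndex v) ∎
    where
      open ≡-Reasoning
      v = liftLeaf ρ u
      index<length : leafIndex u < length (leaves (extend τ (extend ρ (parent u))))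
      index<length = subst (λ x → leafIndex u < length (leaves x)) (extend-∘ τ ρ (parent u))
                           (leafIndex-< (τ ∘I ρ) u-leaf)

  lift : AutI → Fin N → Fin N
  lift τ u with internal? u
  ... | yes u-int = appI τ (u , u-int)
  ... | no  _ = liftLeaf τ u

  lift-internal : ∀ τ {u} → Internal u → lift τ u ≡ extend τ u
  lift-internal τ {u} u-int with internal? u
  ... | yes _      = refl
  ... | no  u-leaf = ⊥-elim (u-leaf u-int)

  lift-leaf : ∀ τ {u} → ¬ Internal u → lift τ u ≡ liftLeaf τ u
  lift-leaf τ {u} u-leaf with internal? u
  ... | yes u-int = ⊥-elim (u-leaf u-int)
  ... | no  _     = refl

  extend-adj-liftLeaf : ∀ τ {u v} → Internal u → ¬ Internal v →
                        adj G (extend τ u) (liftLeaf τ v) ≡ adj G u v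
  extend-adj-liftLeaf τ {u} {v} u-int v-leaf = ⇔→≡ (mk⇔ ⇒adj ⇐adj)
    where
      ⇒adj : adj G (extend τ u) (liftLeaf τ v) ≡ true → adj G u v ≡ true
      ⇒adj e = subst (λ x → adj G x v ≡ true) u≡parent (adj-sym (adj-parent v-leaf))
        where
          u≡parent : parent v ≡ u
          u≡parent = trans (sym (extend-inverseʳ τ (parent v)))
                     (trans (cong (extend (invI τ))
                              (trans (sym (parent-liftLeaf τ v-leaf))
                                     (sym (leaf-adj⇒≡parent (liftLeaf-leaf τ v-leaf) (adj-sym e)))))
                            (extend-inverseʳ τ u))
      ⇐adj : adj G u v ≡ true → adj G (extend τ u) (liftLeaf τ v) ≡ true
      ⇐adj e = subst (λ x → adj G (extend τ x) (liftLeaf τ v) ≡ true)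
                     (sym (leaf-adj⇒≡parent v-leaf (adj-sym e)))
                     (adj-sym (subst (λ x → adj G (liftLeaf τ v) x ≡ true) (parent-liftLeaf τ v-leaf)
                                     (adj-parent (liftLeaf-leaf τ v-leaf))))

  lift-adj : ∀ τ u v → adj G (lift τ u) (lift τ v) ≡ adj G u v
  lift-adj τ u v with internal-or-leaf u | internal-or-leaf v
  ... | inj₁ u-int | inj₁ v-int =
    trans (cong₂ (adj G) (lift-internal τ u-int) (lift-internal τ v-int)) (extend-adj τ u-int v-int)
  ... | inj₁ u-int | inj₂ v-leaf =
    trans (cong₂ (adj G) (lift-internal τ u-int) (lift-leaf τ v-leaf)) (extend-adj-liftLeaf τ u-int v-leaf)
  ... | inj₂ u-leaf | inj₁ v-int =
    trans (cong₂ (adj G) (lift-leaf τ u-leaf) (lift-internal τ v-int))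
          (trans (symm G _ _) (trans (extend-adj-liftLeaf τ v-int u-leaf) (symm G v u)))
  ... | inj₂ u-leaf | inj₂ v-leaf =
    trans (cong₂ (adj G) (lift-leaf τ u-leaf) (lift-leaf τ v-leaf))
          (trans (leaves-nonadjacent (liftLeaf-leaf τ u-leaf) (liftLeaf-leaf τ v-leaf))
                 (sym (leaves-nonadjacent u-leaf v-leaf)))

  lift-∘ : ∀ τ ρ u → lift (τ ∘I ρ) u ≡ lift τ (lift ρ u)
  lift-∘ τ ρ u with internal-or-leaf u
  ... | inj₁ u-int = begin
    lift (τ ∘I ρ) u        ≡⟨ lift-internal (τ ∘I ρ) u-int ⟩
    extend (τ ∘I ρ) u      ≡⟨ extend-∘ τ ρ u ⟩
    extend τ (extend ρ u)  ≡⟨ sym (lift-internal τ (Internal-extend ρ u-int)) ⟩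
    lift τ (extend ρ u)    ≡⟨ cong (lift τ) (sym (lift-internal ρ u-int)) ⟩
    lift τ (lift ρ u)      ∎
    where open ≡-Reasoning
  ... | inj₂ u-leaf = begin
    lift (τ ∘I ρ) u            ≡⟨ lift-leaf (τ ∘I ρ) u-leaf ⟩
    liftLeaf (τ ∘I ρ) u        ≡⟨ liftLeaf-∘ τ ρ u-leaf ⟩
    liftLeaf τ (liftLeaf ρ u)  ≡⟨ sym (lift-leaf τ (liftLeaf-leaf ρ u-leaf)) ⟩
    lift τ (liftLeaf ρ u)      ≡⟨ cong (lift τ) (sym (lift-leaf ρ u-leaf)) ⟩
    lift τ (lift ρ u)          ∎
    where open ≡-Reasoning

  lift-cong : ∀ {τ ρ} → τ ≈I ρ → ∀ u → lift τ u ≡ lift ρ u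
  lift-cong {τ} {ρ} τ≈ρ u with internal-or-leaf u
  ... | inj₁ u-int  = trans (lift-internal τ u-int)
                            (trans (extend-cong τ≈ρ u) (sym (lift-internal ρ u-int)))
  ... | inj₂ u-leaf = trans (lift-leaf τ u-leaf)
                            (trans (cong (λ x → lookupOr u (leaves x) (leafIndex u)) (extend-cong τ≈ρ (parent u)))
                                   (sym (lift-leaf ρ u-leaf)))

  lift-id : ∀ u → lift idI u ≡ u
  lift-id u with internal-or-leaf u
  ... | inj₁ u-int  = trans (lift-internal idI u-int) (extend-id u)
  ... | inj₂ u-leaf = trans (lift-leaf idI u-leaf)
                            (trans (cong (λ x → lookupOr u (leaves x) (leafIndex u)) (extend-id (parent u)))
                                   (lookupOr-indexOf _≟ᶠ_ u (∈-leaves-parent u-leaf)))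

  lift-inverseˡ : ∀ τ u → lift τ (lift (invI τ) u) ≡ u
  lift-inverseˡ τ u = trans (sym (lift-∘ τ (invI τ) u)) (trans (lift-cong (invI-inverseʳ τ) u) (lift-id u))

  lift-inverseʳ : ∀ τ u → lift (invI τ) (lift τ u) ≡ u
  lift-inverseʳ τ u = trans (sym (lift-∘ (invI τ) τ u)) (trans (lift-cong (invI-inverseˡ τ) u) (lift-id u))

  ψ : AutI → Aut
  ψ τ = record
    { perm      = permutation (lift τ) (lift (invI τ)) (lift-inverseˡ τ) (lift-inverseʳ τ)
    ; preserves = lift-adj τ
    }

  Res-ψ : ∀ τ → Res (ψ τ) ≈I τ
  Res-ψ τ (a , a-int) = trans (lift-internal τ a-int) (extend-internal τ a-int)

  ψ-cong : ∀ τ ρ → τ ≈I ρ → ψ τ ≈A ψ ρ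
  ψ-cong τ ρ τ≈ρ = lift-cong τ≈ρ

  ψ-∘ : ∀ τ ρ → ψ (τ ∘I ρ) ≈A (ψ τ ∘A ψ ρ)
  ψ-∘ = lift-∘

  factor≈Res : ∀ σ k τ → InKer k → σ ≈A (k ∘A ψ τ) → τ ≈I Res σ
  factor≈Res σ k τ k∈ker σ≈kψτ x@(a , a-int) =
    sym (trans (σ≈kψτ a) (trans (cong (app k) (Res-ψ τ x)) (k∈ker (to τ x))))

  factorisation : ∀ (σ : Aut) → Σ Aut (λ k → Σ AutI (λ τ →
                    InKer k × (σ ≈A (k ∘A ψ τ))
                  × (∀ k′ τ′ → InKer k′ → σ ≈A (k′ ∘A ψ τ′) → (k′ ≈A k) × (τ′ ≈I τ))))
  factorisation σ = k , Res σ , k∈ker , σ≈kψ , unique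
    where
      k : Aut
      k = σ ∘A ψ (invI (Res σ))

      k∈ker : InKer k
      k∈ker x = trans (cong (app σ) (Res-ψ (invI (Res σ)) x)) (cong proj₁ (to-from (Res σ) x))

      σ≈kψ : σ ≈A (k ∘A ψ (Res σ))
      σ≈kψ v = cong (app σ) (sym (lift-inverseʳ (Res σ) v))

      unique : ∀ k′ τ′ → InKer k′ → σ ≈A (k′ ∘A ψ τ′) → (k′ ≈A k) × (τ′ ≈I Res σ)
      unique k′ τ′ k′∈ker σ≈k′ψτ′ = k′≈k , τ′≈Res
        where
          τ′≈Res : τ′ ≈I Res σ
          τ′≈Res = factor≈Res σ k′ τ′ k′∈ker σ≈k′ψτ′

          k′≈k : k′ ≈A k
          k′≈k v = begin
            app k′ v                                 ≡⟨ cong (app k′) (sym (lift-inverseˡ τ′ v)) ⟩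
            app k′ (lift τ′ (lift (invI τ′) v))      ≡⟨ sym (σ≈k′ψτ′ (lift (invI τ′) v)) ⟩
            app σ (lift (invI τ′) v)                 ≡⟨ cong (app σ) (lift-cong (invI-cong {τ′} {Res σ} τ′≈Res) v) ⟩
            app σ (lift (invI (Res σ)) v)            ∎
            where open ≡-Reasoning

theorem3p8 :
    (n N : ℕ) → 2 ≤ n → 3 ≤ N →
    (G : Graph N) →
    let open Tree G in
    IsTree →
    (∀ v → valence v ≡ 1 ⊎ valence v ≡ n) →
    -- Res : Aut(T) → Aut(T_i) is surjective (exactness at Aut(T_i);
    -- exactness at Aut_e and at Aut(T) hold by definition of Aut_e = ker Res)
    (∀ (τ : AutI) → ∃ λ (σ : Aut) → Res σ ≈I τ)
    ×
    -- a section ψ of Res which is a group homomorphism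
    Σ (AutI → Aut) (λ ψ →
        (∀ τ ρ → τ ≈I ρ → ψ τ ≈A ψ ρ)
      × (∀ τ → Res (ψ τ) ≈I τ)
      × (∀ τ ρ → ψ (τ ∘I ρ) ≈A (ψ τ ∘A ψ ρ))
      -- Aut(T) ≃ Aut_e ⋊ Aut(T_i): every automorphism factors uniquely
      -- as k ∘ ψ(τ) with k ∈ Aut_e and τ ∈ Aut(T_i)
      × (∀ (σ : Aut) → Σ Aut (λ k → Σ AutI (λ τ →
            InKer k × (σ ≈A (k ∘A ψ τ))
          × (∀ k′ τ′ → InKer k′ → σ ≈A (k′ ∘A ψ τ′) → (k′ ≈A k) × (τ′ ≈I τ))))))
theorem3p8 n N 2≤n 3≤N G (connected , _) valence-1-or-n =
  (λ τ → ψ τ , Res-ψ τ) , ψ , ψ-cong , Res-ψ , ψ-∘ , factorisation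
  where open LeafExtension 2≤n 3≤N G connected valence-1-or-n
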